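{- For polynomials $P_1=(I_1\xleftarrow{n_1}D_1\xrightarrow{d_1}A_1\xrightarrow{a_1}I_1)$ and $P_2=(I_2\xleftarrow{n_2}D_2\xrightarrow{d_2}A_2\xrightarrow{a_2}I_2)$ in $\mathbf{Set}$, let $P_1\oplus P_2=(I_1+I_2\xleftarrow{n_1+n_2}D_1+D_2\xrightarrow{d_1+d_2}A_1+A_2\xrightarrow{a_1+a_2}I_1+I_2)$ (with $+$ disjoint union). Then $\oplus$ is both a product and a coproduct in $\mathsf{PE}_{\mathbf{Set}}$, and the polynomial $0=(\emptyset\leftarrow\emptyset\to\emptyset\to\emptyset)$ is a zero object of $\mathsf{PE}_{\mathbf{Set}}$.
   Context: A polynomial over a set $I$ is a diagram of functions $I\xleftarrow{n}D\xrightarrow{d}A\xrightarrow{a}I$. A simulation from $P_1$ to $P_2$ consists of: a span $I_1\xleftarrow{r_1}R\xrightarrow{r_2}I_2$; writing $R\cdot A_1$ for the pullback of $a_1$ along $r_1$ (projections $x$ to $R$, $y$ to $A_1$), a function $\alpha:R\cdot A_1\to A_2$ with $a_2\alpha=r_2x$; writing $R\cdot D_2$ for the pullback of $d_2$ along $\alpha$ (projections $p$, $q$ to $R\cdot A_1$, $D_2$), functions $\beta:R\cdot D_2\to D_1$, $\gamma:R\cdot D_2\to R$ with $d_1\beta=yp$, $n_1\beta=r_1\gamma$, $n_2q=r_2\gamma$. Simulations are identified when there is an isomorphism of spans transporting $\alpha,\beta,\gamma$. Composition: span $R\times_{I_2}R'$, $\alpha''(r,r',a_1)=\alpha'(r',\alpha(r,a_1))$,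 and for $d_3$ over $\alpha''$, with $d_2=\beta'(r',\alpha(r,a_1),d_3)$, $\beta''=\beta(r,a_1,d_2)$, $\gamma''=(\gamma(r,a_1,d_2),\gamma'(r',\alpha(r,a_1),d_3))$; identities have span $I\xleftarrow{1}I\xrightarrow{1}I$, $\alpha=1$, $\beta=1$, $\gamma=n$. $\mathsf{PE}_{\mathbf{Set}}$ has polynomials as objects and equivalence classes of simulations as morphisms. -}

module Defs where

open import Data.Product using (Σ; _×_; _,_; proj₁; proj₂)
open import Data.Sum using (_⊎_) renaming (map to ⊎-map)
open import Data.Empty using (⊥)
open import Function using (id)
open import Relation.Binary.PropositionalEquality using (_≡_; refl; sym; trans; cong)

record Poly : Set₁ where
  field
    I D A : Set
    n : D → I
    d : D → A
    a : A → I
open Poly public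

-- Pullback  R·A₁  of  a₁ : A₁ → I₁  along  r₁ : R → I₁.
-- An element is (r , x , e) with e : a₁ x ≡ r₁ r; projections x = proj₁, y = proj₁ ∘ proj₂.
PbA : (P : Poly) {R : Set} → (R → I P) → Set
PbA P {R} r₁ = Σ R λ r → Σ (A P) λ x → a P x ≡ r₁ r

-- Pullback  R·D₂  of  d₂ : D₂ → A₂  along  α : X → A₂.
-- An element is (p , e , eq) with eq : d₂ e ≡ α p; projections p = proj₁, q = proj₁ ∘ proj₂.
PbD : (Q : Poly) {X : Set} → (X → A Q) → Set
PbD Q {X} α = Σ X λ p → Σ (D Q) λ e → d Q e ≡ α p

record Sim (P₁ P₂ : Poly) : Set₁ where
  field
    R : Set
    r₁ : R → I P₁
    r₂ : R → I P₂
    α : PbA P₁ r₁ → A P₂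
    α-ok : (p : PbA P₁ r₁) → a P₂ (α p) ≡ r₂ (proj₁ p)
    β : PbD P₂ α → D P₁
    γ : PbD P₂ α → R
    β-d : (t : PbD P₂ α) → d P₁ (β t) ≡ proj₁ (proj₂ (proj₁ t))
    β-n : (t : PbD P₂ α) → n P₁ (β t) ≡ r₁ (γ t)
    γ-n : (t : PbD P₂ α) → n P₂ (proj₁ (proj₂ t)) ≡ r₂ (γ t)

record SimEquiv {P₁ P₂ : Poly} (S T : Sim P₁ P₂) : Set where
  private
    module S = Sim S
    module T = Sim T
  field
    φ : S.R → T.R
    ψ : T.R → S.R
    ψφ : (r : S.R) → ψ (φ r) ≡ r
    φψ : (r : T.R) → φ (ψ r) ≡ r
    φ-r₁ : (r : S.R) → T.r₁ (φ r) ≡ S.r₁ r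
    φ-r₂ : (r : S.R) → T.r₂ (φ r) ≡ S.r₂ r
  φA : PbA P₁ S.r₁ → PbA P₁ T.r₁
  φA (r , x , e) = φ r , x , trans e (sym (φ-r₁ r))
  field
    φ-α : (p : PbA P₁ S.r₁) → T.α (φA p) ≡ S.α p
  φD : PbD P₂ S.α → PbD P₂ T.α
  φD (p , e , eq) = φA p , e , trans eq (sym (φ-α p))
  field
    φ-β : (t : PbD P₂ S.α) → T.β (φD t) ≡ S.β t
    φ-γ : (t : PbD P₂ S.α) → T.γ (φD t) ≡ φ (S.γ t)

_≈S_ : {P₁ P₂ : Poly} → Sim P₁ P₂ → Sim P₁ P₂ → Set
S ≈S T = SimEquiv S T

idSim : (P : Poly) → Sim P P
idSim P = record
  { R = I P ; r₁ = id ; r₂ = id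
  ; α = λ p → proj₁ (proj₂ p)
  ; α-ok = λ p → proj₂ (proj₂ p)
  ; β = λ t → proj₁ (proj₂ t)
  ; γ = λ t → n P (proj₁ (proj₂ t))
  ; β-d = λ t → proj₂ (proj₂ t)
  ; β-n = λ t → refl
  ; γ-n = λ t → refl
  }

_∘S_ : {P₁ P₂ P₃ : Poly} → Sim P₂ P₃ → Sim P₁ P₂ → Sim P₁ P₃
_∘S_ {P₁} {P₂} {P₃} S' S = record
  { R = R''
  ; r₁ = λ u → S.r₁ (proj₁ (proj₁ u))
  ; r₂ = λ u → S'.r₂ (proj₂ (proj₁ u))
  ; α = α''
  ; α-ok = λ p → S'.α-ok (inner p)
  ; β = λ t → S.β (outer t)
  ; γ = λ t → (S.γ (outer t) , S'.γ (mid t)) , glue t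
  ; β-d = λ t → S.β-d (outer t)
  ; β-n = λ t → S.β-n (outer t)
  ; γ-n = λ t → S'.γ-n (mid t)
  }
  where
  module S = Sim S
  module S' = Sim S'
  R'' : Set
  R'' = Σ (S.R × S'.R) λ u → S.r₂ (proj₁ u) ≡ S'.r₁ (proj₂ u)
  first' : PbA P₁ (λ (u : R'') → S.r₁ (proj₁ (proj₁ u))) → PbA P₁ S.r₁
  first' (((r , r') , e) , x , ex) = r , x , ex
  inner : PbA P₁ (λ (u : R'') → S.r₁ (proj₁ (proj₁ u))) → PbA P₂ S'.r₁
  inner (((r , r') , e) , x , ex) = r' , S.α (r , x , ex) , trans (S.α-ok (r , x , ex)) e
  α'' : PbA P₁ (λ (u : R'') → S.r₁ (proj₁ (proj₁ u))) → A P₃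
  α'' p = S'.α (inner p)
  mid : PbD P₃ α'' → PbD P₃ S'.α
  mid (p , e₃ , eq) = inner p , e₃ , eq
  outer : PbD P₃ α'' → PbD P₂ S.α
  outer (p , e₃ , eq) = first' p , S'.β (mid (p , e₃ , eq)) , S'.β-d (mid (p , e₃ , eq))
  glue : (t : PbD P₃ α'') → S.r₂ (S.γ (outer t)) ≡ S'.r₁ (S'.γ (mid t))
  glue t = trans (sym (S.γ-n (outer t))) (S'.β-n (mid t))

_⊕_ : Poly → Poly → Poly
P ⊕ Q = record
  { I = I P ⊎ I Q ; D = D P ⊎ D Q ; A = A P ⊎ A Q
  ; n = ⊎-map (n P) (n Q) ; d = ⊎-map (d P) (d Q) ; a = ⊎-map (a P) (a Q) }

Zero : Poly
Zero = record { I = ⊥ ; D = ⊥ ; A = ⊥ ; n = λ () ; d = λ () ; a = λ () }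

-- Universal properties in PE_Set (morphisms = simulations up to ≈S).
IsProduct : (P₁ P₂ S : Poly) → Set₁
IsProduct P₁ P₂ S =
  Σ (Sim S P₁) λ π₁ → Σ (Sim S P₂) λ π₂ →
    (X : Poly) (f : Sim X P₁) (g : Sim X P₂) →
      Σ (Sim X S) λ h → ((π₁ ∘S h) ≈S f) × ((π₂ ∘S h) ≈S g)
        × ((h' : Sim X S) → (π₁ ∘S h') ≈S f → (π₂ ∘S h') ≈S g → h' ≈S h)

IsCoproduct : (P₁ P₂ S : Poly) → Set₁
IsCoproduct P₁ P₂ S =
  Σ (Sim P₁ S) λ ι₁ → Σ (Sim P₂ S) λ ι₂ →
    (X : Poly) (f : Sim P₁ X) (g : Sim P₂ X) →
      Σ (Sim S X) λ h → ((h ∘S ι₁) ≈S f) × ((h ∘S ι₂) ≈S g)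
        × ((h' : Sim S X) → (h' ∘S ι₁) ≈S f → (h' ∘S ι₂) ≈S g → h' ≈S h)

IsInitial : Poly → Set₁
IsInitial Z = (X : Poly) → Σ (Sim Z X) λ f → (g : Sim Z X) → g ≈S f

IsTerminal : Poly → Set₁
IsTerminal Z = (X : Poly) → Σ (Sim X Z) λ f → (g : Sim X Z) → g ≈S f

IsZeroObject : Poly → Set₁
IsZeroObject Z = IsInitial Z × IsTerminal Z

module Submission where

-- Every construction below is explicit, so the work lies in producing the
-- span isomorphisms witnessing equivalences of simulations.  Three general
-- facts organise this:
--   * by UIP a point of a pullback is determined by its coordinates, so the
--     components α, β, γ of a simulation ignore the equation witnesses;
--   * consequently an equivalence S ≈S T is given by a span isomorphism φ
--     satisfying the α/β/γ conditions for arbitrary witnesses (≈-intro);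
--   * any two simulations with empty span are equivalent (empty-≈).
-- The zero object follows at once: every simulation into or out of 0 has an
-- empty span.  For ⊕ we build projections π₁, π₂ (resp. injections ι₁, ι₂) and,
-- from f and g, a mediating simulation with span R_f ⊎ R_g; the composites
-- recover f and g, and any other mediating h' is equivalent to it through the
-- bijection sending r ∈ R_h' to the summand selected by its image in I₁ ⊎ I₂.

open import Defs
open import Data.Product using (_×_; _,_; proj₁; proj₂)
open import Data.Sum using (_⊎_; inj₁; inj₂) renaming (map to ⊎-map; [_,_] to ⊎-elim)
open import Data.Sum.Properties using (inj₁-injective; inj₂-injective)
open import Data.Empty using (⊥; ⊥-elim)
open import Function using (id)
open import Relation.Binary.PropositionalEquality using (_≡_; refl; sym; trans; cong)
open import Axiom.UniquenessOfIdentityProofs.WithK using (uip)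

PbA-≡ : (P : Poly) {R : Set} (r₁ : R → I P) {r : R} {x : A P} (e e' : a P x ≡ r₁ r)
      → _≡_ {A = PbA P r₁} (r , x , e) (r , x , e')
PbA-≡ P r₁ e e' = cong (λ z → _ , _ , z) (uip e e')

PbD-≡ : (Q : Poly) {X : Set} (α : X → A Q) {p p' : X} → p ≡ p'
      → {z : D Q} (q : d Q z ≡ α p) (q' : d Q z ≡ α p')
      → _≡_ {A = PbD Q α} (p , z , q) (p' , z , q')
PbD-≡ Q α refl q q' = cong (λ w → _ , _ , w) (uip q q')

module _ {P Q : Poly} (S : Sim P Q) where
  open Sim S

  α-irr : ∀ {r x} (e e' : a P x ≡ r₁ r) → α (r , x , e) ≡ α (r , x , e')
  α-irr e e' = cong α (PbA-≡ P r₁ e e')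

  β-irr : ∀ {r x} (e e' : a P x ≡ r₁ r) {z} (q : d Q z ≡ α (r , x , e)) (q' : d Q z ≡ α (r , x , e'))
        → β ((r , x , e) , z , q) ≡ β ((r , x , e') , z , q')
  β-irr e e' q q' = cong β (PbD-≡ Q α (PbA-≡ P r₁ e e') q q')

  γ-irr : ∀ {r x} (e e' : a P x ≡ r₁ r) {z} (q : d Q z ≡ α (r , x , e)) (q' : d Q z ≡ α (r , x , e'))
        → γ ((r , x , e) , z , q) ≡ γ ((r , x , e') , z , q')
  γ-irr e e' q q' = cong γ (PbD-≡ Q α (PbA-≡ P r₁ e e') q q')

-- An equivalence S ≈S T from a span isomorphism φ whose α/β/γ conditions are
-- checked against arbitrary witnesses, so no transported witness ever appears.
≈-intro : {P Q : Poly} (S T : Sim P Q) → let module S = Sim S; module T = Sim T in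
    (φ : S.R → T.R) (ψ : T.R → S.R) → (∀ r → ψ (φ r) ≡ r) → (∀ r → φ (ψ r) ≡ r)
  → (∀ r → T.r₁ (φ r) ≡ S.r₁ r) → (∀ r → T.r₂ (φ r) ≡ S.r₂ r)
  → (∀ r x (e : a P x ≡ S.r₁ r) (e' : a P x ≡ T.r₁ (φ r))
       → T.α (φ r , x , e') ≡ S.α (r , x , e))
  → (∀ r x (e : a P x ≡ S.r₁ r) (e' : a P x ≡ T.r₁ (φ r)) z
       (q : d Q z ≡ S.α (r , x , e)) (q' : d Q z ≡ T.α (φ r , x , e'))
       → T.β ((φ r , x , e') , z , q') ≡ S.β ((r , x , e) , z , q))
  → (∀ r x (e : a P x ≡ S.r₁ r) (e' : a P x ≡ T.r₁ (φ r)) z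
       (q : d Q z ≡ S.α (r , x , e)) (q' : d Q z ≡ T.α (φ r , x , e'))
       → T.γ ((φ r , x , e') , z , q') ≡ φ (S.γ ((r , x , e) , z , q)))
  → S ≈S T
≈-intro S T φ ψ ψφ φψ φ-r₁ φ-r₂ φ-α φ-β φ-γ = record
  { φ = φ ; ψ = ψ ; ψφ = ψφ ; φψ = φψ ; φ-r₁ = φ-r₁ ; φ-r₂ = φ-r₂
  ; φ-α = λ { (r , x , e) → φ-α r x e _ }
  ; φ-β = λ { ((r , x , e) , z , q) → φ-β r x e _ z q _ }
  ; φ-γ = λ { ((r , x , e) , z , q) → φ-γ r x e _ z q _ } }

emptySim : (P Q : Poly) → Sim P Q
emptySim P Q = record
  { R = ⊥ ; r₁ = λ () ; r₂ = λ ()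
  ; α = λ { (() , _) } ; α-ok = λ { (() , _) }
  ; β = λ { ((() , _) , _) } ; γ = λ { ((() , _) , _) }
  ; β-d = λ { ((() , _) , _) } ; β-n = λ { ((() , _) , _) } ; γ-n = λ { ((() , _) , _) } }

empty-≈ : {P Q : Poly} (S : Sim P Q) → (Sim.R S → ⊥) → S ≈S emptySim P Q
empty-≈ S empty = ≈-intro S (emptySim _ _) empty (λ ()) (λ r → ⊥-elim (empty r)) (λ ())
  (λ r → ⊥-elim (empty r)) (λ r → ⊥-elim (empty r))
  (λ r → ⊥-elim (empty r)) (λ r → ⊥-elim (empty r)) (λ r → ⊥-elim (empty r))

-- A simulation out of 0 has its span over I 0 = ⊥, so it is empty.
zero-initial : IsInitial Zero
zero-initial X = emptySim Zero X , λ g → empty-≈ g (Sim.r₁ g)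

-- Dually a simulation into 0 has an empty span.
zero-terminal : IsTerminal Zero
zero-terminal X = emptySim X Zero , λ g → empty-≈ g (Sim.r₂ g)

module Product (P₁ P₂ : Poly) where

  -- The projection π₁ has span I₁ ⊎ I₂ ←inj₁− I₁ −id→ I₁.  Over inj₁ i every
  -- action of P₁ ⊕ P₂ is some inj₁ x, and α₁ reads off x.
  α₁ : PbA (P₁ ⊕ P₂) {I P₁} inj₁ → A P₁
  α₁ (i , inj₁ x , _) = x
  α₁ (i , inj₂ x , ())

  inj₁-α₁ : ∀ i y (e : a (P₁ ⊕ P₂) y ≡ inj₁ i) → inj₁ (α₁ (i , y , e)) ≡ y
  inj₁-α₁ i (inj₁ x) e = refl
  inj₁-α₁ i (inj₂ x) ()

  π₁ : Sim (P₁ ⊕ P₂) P₁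
  π₁ = record
    { R = I P₁ ; r₁ = inj₁ ; r₂ = id
    ; α = α₁
    ; α-ok = λ { (i , y , e) → inj₁-injective (trans (cong (a (P₁ ⊕ P₂)) (inj₁-α₁ i y e)) e) }
    ; β = λ t → inj₁ (proj₁ (proj₂ t)) ; γ = λ t → n P₁ (proj₁ (proj₂ t))
    ; β-d = λ { ((i , y , e) , z , q) → trans (cong inj₁ q) (inj₁-α₁ i y e) }
    ; β-n = λ t → refl ; γ-n = λ t → refl }

  α₂ : PbA (P₁ ⊕ P₂) {I P₂} inj₂ → A P₂
  α₂ (i , inj₂ x , _) = x
  α₂ (i , inj₁ x , ())

  inj₂-α₂ : ∀ i y (e : a (P₁ ⊕ P₂) y ≡ inj₂ i) → inj₂ (α₂ (i , y , e)) ≡ y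
  inj₂-α₂ i (inj₂ x) e = refl
  inj₂-α₂ i (inj₁ x) ()

  π₂ : Sim (P₁ ⊕ P₂) P₂
  π₂ = record
    { R = I P₂ ; r₁ = inj₂ ; r₂ = id
    ; α = α₂
    ; α-ok = λ { (i , y , e) → inj₂-injective (trans (cong (a (P₁ ⊕ P₂)) (inj₂-α₂ i y e)) e) }
    ; β = λ t → inj₂ (proj₁ (proj₂ t)) ; γ = λ t → n P₂ (proj₁ (proj₂ t))
    ; β-d = λ { ((i , y , e) , z , q) → trans (cong inj₂ q) (inj₂-α₂ i y e) }
    ; β-n = λ t → refl ; γ-n = λ t → refl }

  module Pairing (X : Poly) (f : Sim X P₁) (g : Sim X P₂) where
    private
      module f = Sim f
      module g = Sim g

    hR : Set
    hR = f.R ⊎ g.R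

    hr₁ : hR → I X
    hr₁ = ⊎-elim f.r₁ g.r₁

    hr₂ : hR → I P₁ ⊎ I P₂
    hr₂ = ⊎-map f.r₂ g.r₂

    hα : PbA X hr₁ → A P₁ ⊎ A P₂
    hα (inj₁ r , x , e) = inj₁ (f.α (r , x , e))
    hα (inj₂ r , x , e) = inj₂ (g.α (r , x , e))

    hα-ok : (p : PbA X hr₁) → a (P₁ ⊕ P₂) (hα p) ≡ hr₂ (proj₁ p)
    hα-ok (inj₁ r , x , e) = cong inj₁ (f.α-ok (r , x , e))
    hα-ok (inj₂ r , x , e) = cong inj₂ (g.α-ok (r , x , e))

    hβ : PbD (P₁ ⊕ P₂) hα → D X
    hβ ((inj₁ r , x , e) , inj₁ z , q) = f.β ((r , x , e) , z , inj₁-injective q)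
    hβ ((inj₁ r , x , e) , inj₂ z , ())
    hβ ((inj₂ r , x , e) , inj₁ z , ())
    hβ ((inj₂ r , x , e) , inj₂ z , q) = g.β ((r , x , e) , z , inj₂-injective q)

    hγ : PbD (P₁ ⊕ P₂) hα → hR
    hγ ((inj₁ r , x , e) , inj₁ z , q) = inj₁ (f.γ ((r , x , e) , z , inj₁-injective q))
    hγ ((inj₁ r , x , e) , inj₂ z , ())
    hγ ((inj₂ r , x , e) , inj₁ z , ())
    hγ ((inj₂ r , x , e) , inj₂ z , q) = inj₂ (g.γ ((r , x , e) , z , inj₂-injective q))

    hβ-d : (t : PbD (P₁ ⊕ P₂) hα) → d X (hβ t) ≡ proj₁ (proj₂ (proj₁ t))
    hβ-d ((inj₁ r , x , e) , inj₁ z , q) = f.β-d _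
    hβ-d ((inj₁ r , x , e) , inj₂ z , ())
    hβ-d ((inj₂ r , x , e) , inj₁ z , ())
    hβ-d ((inj₂ r , x , e) , inj₂ z , q) = g.β-d _

    hβ-n : (t : PbD (P₁ ⊕ P₂) hα) → n X (hβ t) ≡ hr₁ (hγ t)
    hβ-n ((inj₁ r , x , e) , inj₁ z , q) = f.β-n _
    hβ-n ((inj₁ r , x , e) , inj₂ z , ())
    hβ-n ((inj₂ r , x , e) , inj₁ z , ())
    hβ-n ((inj₂ r , x , e) , inj₂ z , q) = g.β-n _

    hγ-n : (t : PbD (P₁ ⊕ P₂) hα) → n (P₁ ⊕ P₂) (proj₁ (proj₂ t)) ≡ hr₂ (hγ t)
    hγ-n ((inj₁ r , x , e) , inj₁ z , q) = cong inj₁ (f.γ-n _)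
    hγ-n ((inj₁ r , x , e) , inj₂ z , ())
    hγ-n ((inj₂ r , x , e) , inj₁ z , ())
    hγ-n ((inj₂ r , x , e) , inj₂ z , q) = cong inj₂ (g.γ-n _)

    pair : Sim X (P₁ ⊕ P₂)
    pair = record
      { R = hR ; r₁ = hr₁ ; r₂ = hr₂ ; α = hα ; α-ok = hα-ok ; β = hβ ; γ = hγ
      ; β-d = hβ-d ; β-n = hβ-n ; γ-n = hγ-n }

    -- The span of π₁ ∘ pair is {(r , i) | hr₂ r ≡ inj₁ i} ≅ R_f, on which the
    -- composite acts exactly as f.
    π₁-pair-R : Sim.R (π₁ ∘S pair) → f.R
    π₁-pair-R ((inj₁ r , i) , _) = r
    π₁-pair-R ((inj₂ r , i) , ())

    π₁-pair : (π₁ ∘S pair) ≈S f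
    π₁-pair = ≈-intro (π₁ ∘S pair) f π₁-pair-R (λ r → (inj₁ r , f.r₂ r) , refl)
      (λ { ((inj₁ r , i) , refl) → refl ; ((inj₂ r , i) , ()) })
      (λ r → refl)
      (λ { ((inj₁ r , i) , _) → refl ; ((inj₂ r , i) , ()) })
      (λ { ((inj₁ r , i) , refl) → refl ; ((inj₂ r , i) , ()) })
      (λ { ((inj₁ r , i) , _) x e e' → α-irr f e' e ; ((inj₂ r , i) , ()) })
      (λ { ((inj₁ r , i) , _) x e e' z q q' → β-irr f e' e q' _ ; ((inj₂ r , i) , ()) })
      (λ { ((inj₁ r , i) , _) x e e' z q q' → γ-irr f e' e q' _ ; ((inj₂ r , i) , ()) })

    π₂-pair-R : Sim.R (π₂ ∘S pair) → g.R
    π₂-pair-R ((inj₂ r , i) , _) = r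
    π₂-pair-R ((inj₁ r , i) , ())

    π₂-pair : (π₂ ∘S pair) ≈S g
    π₂-pair = ≈-intro (π₂ ∘S pair) g π₂-pair-R (λ r → (inj₂ r , g.r₂ r) , refl)
      (λ { ((inj₂ r , i) , refl) → refl ; ((inj₁ r , i) , ()) })
      (λ r → refl)
      (λ { ((inj₂ r , i) , _) → refl ; ((inj₁ r , i) , ()) })
      (λ { ((inj₂ r , i) , refl) → refl ; ((inj₁ r , i) , ()) })
      (λ { ((inj₂ r , i) , _) x e e' → α-irr g e' e ; ((inj₁ r , i) , ()) })
      (λ { ((inj₂ r , i) , _) x e e' z q q' → β-irr g e' e q' _ ; ((inj₁ r , i) , ()) })
      (λ { ((inj₂ r , i) , _) x e e' z q q' → γ-irr g e' e q' _ ; ((inj₁ r , i) , ()) })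

  module PairingUnique (X : Poly) (f : Sim X P₁) (g : Sim X P₂) (h' : Sim X (P₁ ⊕ P₂))
                       (E₁ : (π₁ ∘S h') ≈S f) (E₂ : (π₂ ∘S h') ≈S g) where
    open Pairing X f g
    private
      module h' = Sim h'
      module E₁ = SimEquiv E₁
      module E₂ = SimEquiv E₂
      module C₁ = Sim (π₁ ∘S h')
      module C₂ = Sim (π₂ ∘S h')

    -- r ∈ R_h' lies over one summand v of I₁ ⊎ I₂, hence in the span of
    -- π₁ ∘ h' or of π₂ ∘ h', which E₁ resp. E₂ identify with R_f resp. R_g.
    split : (r : h'.R) (v : I P₁ ⊎ I P₂) → h'.r₂ r ≡ v → hR
    split r (inj₁ i) e = inj₁ (E₁.φ ((r , i) , e))
    split r (inj₂ j) e = inj₂ (E₂.φ ((r , j) , e))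

    φ : h'.R → hR
    φ r = split r (h'.r₂ r) refl

    φ-split : ∀ r v (e : h'.r₂ r ≡ v) → φ r ≡ split r v e
    φ-split r _ refl = refl

    ψ : hR → h'.R
    ψ (inj₁ s) = proj₁ (proj₁ (E₁.ψ s))
    ψ (inj₂ s) = proj₁ (proj₁ (E₂.ψ s))

    ψ-split : ∀ r v e → ψ (split r v e) ≡ r
    ψ-split r (inj₁ i) e = cong (λ c → proj₁ (proj₁ c)) (E₁.ψφ ((r , i) , e))
    ψ-split r (inj₂ j) e = cong (λ c → proj₁ (proj₁ c)) (E₂.ψφ ((r , j) , e))

    φψ : ∀ s → φ (ψ s) ≡ s
    φψ (inj₁ s) = trans (φ-split _ _ (proj₂ (E₁.ψ s))) (cong inj₁ (E₁.φψ s))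
    φψ (inj₂ s) = trans (φ-split _ _ (proj₂ (E₂.ψ s))) (cong inj₂ (E₂.φψ s))

    split-r₁ : ∀ r v e → hr₁ (split r v e) ≡ h'.r₁ r
    split-r₁ r (inj₁ i) e = E₁.φ-r₁ ((r , i) , e)
    split-r₁ r (inj₂ i) e = E₂.φ-r₁ ((r , i) , e)

    split-r₂ : ∀ r v e → hr₂ (split r v e) ≡ h'.r₂ r
    split-r₂ r (inj₁ i) e = trans (cong inj₁ (E₁.φ-r₂ ((r , i) , e))) (sym e)
    split-r₂ r (inj₂ i) e = trans (cong inj₂ (E₂.φ-r₂ ((r , i) , e))) (sym e)

    split-α : ∀ r v ev x (e : a X x ≡ h'.r₁ r) (e' : a X x ≡ hr₁ (split r v ev))
            → hα (split r v ev , x , e') ≡ h'.α (r , x , e)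
    split-α r (inj₁ i) ev x e e' =
      trans (cong inj₁ (trans (α-irr f e' _) (E₁.φ-α (((r , i) , ev) , x , e))))
            (inj₁-α₁ i (h'.α (r , x , e)) _)
    split-α r (inj₂ i) ev x e e' =
      trans (cong inj₂ (trans (α-irr g e' _) (E₂.φ-α (((r , i) , ev) , x , e))))
            (inj₂-α₂ i (h'.α (r , x , e)) _)

    split-β : ∀ r v ev x (e : a X x ≡ h'.r₁ r) (e' : a X x ≡ hr₁ (split r v ev)) z
              (q : d (P₁ ⊕ P₂) z ≡ h'.α (r , x , e)) (q' : d (P₁ ⊕ P₂) z ≡ hα (split r v ev , x , e'))
            → hβ ((split r v ev , x , e') , z , q') ≡ h'.β ((r , x , e) , z , q)
    split-β r (inj₁ i) ev x e e' (inj₁ z) q q' =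
      trans (β-irr f e' _ _ _) (trans (E₁.φ-β t) (β-irr h' e e _ q))
      where t = ((((r , i) , ev) , x , e) , z , inj₁-injective (trans q (sym (inj₁-α₁ i _ _))))
    split-β r (inj₁ i) ev x e e' (inj₂ z) q ()
    split-β r (inj₂ i) ev x e e' (inj₂ z) q q' =
      trans (β-irr g e' _ _ _) (trans (E₂.φ-β t) (β-irr h' e e _ q))
      where t = ((((r , i) , ev) , x , e) , z , inj₂-injective (trans q (sym (inj₂-α₂ i _ _))))
    split-β r (inj₂ i) ev x e e' (inj₁ z) q ()

    split-γ : ∀ r v ev x (e : a X x ≡ h'.r₁ r) (e' : a X x ≡ hr₁ (split r v ev)) z
              (q : d (P₁ ⊕ P₂) z ≡ h'.α (r , x , e)) (q' : d (P₁ ⊕ P₂) z ≡ hα (split r v ev , x , e'))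
            → hγ ((split r v ev , x , e') , z , q') ≡ φ (h'.γ ((r , x , e) , z , q))
    split-γ r (inj₁ i) ev x e e' (inj₁ z) q q' =
      trans (cong inj₁ (trans (γ-irr f e' _ _ _) (E₁.φ-γ t)))
        (trans (sym (φ-split _ _ (proj₂ (C₁.γ t)))) (cong φ (γ-irr h' e e _ q)))
      where t = ((((r , i) , ev) , x , e) , z , inj₁-injective (trans q (sym (inj₁-α₁ i _ _))))
    split-γ r (inj₁ i) ev x e e' (inj₂ z) q ()
    split-γ r (inj₂ i) ev x e e' (inj₂ z) q q' =
      trans (cong inj₂ (trans (γ-irr g e' _ _ _) (E₂.φ-γ t)))
        (trans (sym (φ-split _ _ (proj₂ (C₂.γ t)))) (cong φ (γ-irr h' e e _ q)))
      where t = ((((r , i) , ev) , x , e) , z , inj₂-injective (trans q (sym (inj₂-α₂ i _ _))))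
    split-γ r (inj₂ i) ev x e e' (inj₁ z) q ()

    pair-unique : h' ≈S pair
    pair-unique = ≈-intro h' pair φ ψ (λ r → ψ-split r _ refl) φψ
      (λ r → split-r₁ r _ refl) (λ r → split-r₂ r _ refl)
      (λ r → split-α r _ refl) (λ r → split-β r _ refl) (λ r → split-γ r _ refl)

  product : IsProduct P₁ P₂ (P₁ ⊕ P₂)
  product = π₁ , π₂ , λ X f g → let open Pairing X f g in
    pair , π₁-pair , π₂-pair , λ h' E₁ E₂ → PairingUnique.pair-unique X f g h' E₁ E₂

module Coproduct (P₁ P₂ : Poly) where

  -- The injection ι₁ has span I₁ ←id− I₁ −inj₁→ I₁ ⊎ I₂; it sends x to inj₁ x,
  -- and a direction over inj₁ x is some inj₁ z, answered by z.
  ια₁ : PbA P₁ {I P₁} id → A P₁ ⊎ A P₂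
  ια₁ (i , x , e) = inj₁ x

  ιβ₁ : PbD (P₁ ⊕ P₂) ια₁ → D P₁
  ιβ₁ (p , inj₁ z , q) = z
  ιβ₁ (p , inj₂ z , ())

  inj₁-ιβ₁ : ∀ p z (q : d (P₁ ⊕ P₂) z ≡ ια₁ p) → inj₁ (ιβ₁ (p , z , q)) ≡ z
  inj₁-ιβ₁ p (inj₁ z) q = refl
  inj₁-ιβ₁ p (inj₂ z) ()

  ι₁ : Sim P₁ (P₁ ⊕ P₂)
  ι₁ = record
    { R = I P₁ ; r₁ = id ; r₂ = inj₁
    ; α = ια₁ ; α-ok = λ p → cong inj₁ (proj₂ (proj₂ p))
    ; β = ιβ₁ ; γ = λ t → n P₁ (ιβ₁ t)
    ; β-d = λ { (p , z , q) → inj₁-injective (trans (cong (d (P₁ ⊕ P₂)) (inj₁-ιβ₁ p z q)) q) }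
    ; β-n = λ t → refl
    ; γ-n = λ { (p , z , q) → sym (cong (n (P₁ ⊕ P₂)) (inj₁-ιβ₁ p z q)) } }

  ια₂ : PbA P₂ {I P₂} id → A P₁ ⊎ A P₂
  ια₂ (i , x , e) = inj₂ x

  ιβ₂ : PbD (P₁ ⊕ P₂) ια₂ → D P₂
  ιβ₂ (p , inj₂ z , q) = z
  ιβ₂ (p , inj₁ z , ())

  inj₂-ιβ₂ : ∀ p z (q : d (P₁ ⊕ P₂) z ≡ ια₂ p) → inj₂ (ιβ₂ (p , z , q)) ≡ z
  inj₂-ιβ₂ p (inj₂ z) q = refl
  inj₂-ιβ₂ p (inj₁ z) ()

  ι₂ : Sim P₂ (P₁ ⊕ P₂)
  ι₂ = record
    { R = I P₂ ; r₁ = id ; r₂ = inj₂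
    ; α = ια₂ ; α-ok = λ p → cong inj₂ (proj₂ (proj₂ p))
    ; β = ιβ₂ ; γ = λ t → n P₂ (ιβ₂ t)
    ; β-d = λ { (p , z , q) → inj₂-injective (trans (cong (d (P₁ ⊕ P₂)) (inj₂-ιβ₂ p z q)) q) }
    ; β-n = λ t → refl
    ; γ-n = λ { (p , z , q) → sym (cong (n (P₁ ⊕ P₂)) (inj₂-ιβ₂ p z q)) } }

  module Copairing (X : Poly) (f : Sim P₁ X) (g : Sim P₂ X) where
    private
      module f = Sim f
      module g = Sim g

    kR : Set
    kR = f.R ⊎ g.R

    kr₁ : kR → I P₁ ⊎ I P₂
    kr₁ = ⊎-map f.r₁ g.r₁

    kr₂ : kR → I X
    kr₂ = ⊎-elim f.r₂ g.r₂

    kα : PbA (P₁ ⊕ P₂) kr₁ → A X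
    kα (inj₁ r , inj₁ x , e) = f.α (r , x , inj₁-injective e)
    kα (inj₁ r , inj₂ x , ())
    kα (inj₂ r , inj₁ x , ())
    kα (inj₂ r , inj₂ x , e) = g.α (r , x , inj₂-injective e)

    kα-ok : (p : PbA (P₁ ⊕ P₂) kr₁) → a X (kα p) ≡ kr₂ (proj₁ p)
    kα-ok (inj₁ r , inj₁ x , e) = f.α-ok _
    kα-ok (inj₁ r , inj₂ x , ())
    kα-ok (inj₂ r , inj₁ x , ())
    kα-ok (inj₂ r , inj₂ x , e) = g.α-ok _

    kβ : PbD X kα → D P₁ ⊎ D P₂
    kβ ((inj₁ r , inj₁ x , e) , z , q) = inj₁ (f.β ((r , x , inj₁-injective e) , z , q))
    kβ ((inj₁ r , inj₂ x , ()) , z , q)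
    kβ ((inj₂ r , inj₁ x , ()) , z , q)
    kβ ((inj₂ r , inj₂ x , e) , z , q) = inj₂ (g.β ((r , x , inj₂-injective e) , z , q))

    kγ : PbD X kα → kR
    kγ ((inj₁ r , inj₁ x , e) , z , q) = inj₁ (f.γ ((r , x , inj₁-injective e) , z , q))
    kγ ((inj₁ r , inj₂ x , ()) , z , q)
    kγ ((inj₂ r , inj₁ x , ()) , z , q)
    kγ ((inj₂ r , inj₂ x , e) , z , q) = inj₂ (g.γ ((r , x , inj₂-injective e) , z , q))

    kβ-d : (t : PbD X kα) → d (P₁ ⊕ P₂) (kβ t) ≡ proj₁ (proj₂ (proj₁ t))
    kβ-d ((inj₁ r , inj₁ x , e) , z , q) = cong inj₁ (f.β-d _)
    kβ-d ((inj₁ r , inj₂ x , ()) , z , q)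
    kβ-d ((inj₂ r , inj₁ x , ()) , z , q)
    kβ-d ((inj₂ r , inj₂ x , e) , z , q) = cong inj₂ (g.β-d _)

    kβ-n : (t : PbD X kα) → n (P₁ ⊕ P₂) (kβ t) ≡ kr₁ (kγ t)
    kβ-n ((inj₁ r , inj₁ x , e) , z , q) = cong inj₁ (f.β-n _)
    kβ-n ((inj₁ r , inj₂ x , ()) , z , q)
    kβ-n ((inj₂ r , inj₁ x , ()) , z , q)
    kβ-n ((inj₂ r , inj₂ x , e) , z , q) = cong inj₂ (g.β-n _)

    kγ-n : (t : PbD X kα) → n X (proj₁ (proj₂ t)) ≡ kr₂ (kγ t)
    kγ-n ((inj₁ r , inj₁ x , e) , z , q) = f.γ-n _
    kγ-n ((inj₁ r , inj₂ x , ()) , z , q)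
    kγ-n ((inj₂ r , inj₁ x , ()) , z , q)
    kγ-n ((inj₂ r , inj₂ x , e) , z , q) = g.γ-n _

    copair : Sim (P₁ ⊕ P₂) X
    copair = record
      { R = kR ; r₁ = kr₁ ; r₂ = kr₂ ; α = kα ; α-ok = kα-ok ; β = kβ ; γ = kγ
      ; β-d = kβ-d ; β-n = kβ-n ; γ-n = kγ-n }

    -- The span of copair ∘ ι₁ is {(i , r) | inj₁ i ≡ kr₁ r} ≅ R_f, on which the
    -- composite acts exactly as f.
    copair-ι₁-R : Sim.R (copair ∘S ι₁) → f.R
    copair-ι₁-R ((i , inj₁ r) , _) = r
    copair-ι₁-R ((i , inj₂ r) , ())

    copair-ι₁ : (copair ∘S ι₁) ≈S f
    copair-ι₁ = ≈-intro (copair ∘S ι₁) f copair-ι₁-R (λ r → (f.r₁ r , inj₁ r) , refl)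
      (λ { ((i , inj₁ r) , refl) → refl ; ((i , inj₂ r) , ()) })
      (λ r → refl)
      (λ { ((i , inj₁ r) , refl) → refl ; ((i , inj₂ r) , ()) })
      (λ { ((i , inj₁ r) , _) → refl ; ((i , inj₂ r) , ()) })
      (λ { ((i , inj₁ r) , _) x e e' → α-irr f e' _ ; ((i , inj₂ r) , ()) })
      (λ { ((i , inj₁ r) , _) x e e' z q q' → β-irr f e' _ q' q ; ((i , inj₂ r) , ()) })
      (λ { ((i , inj₁ r) , _) x e e' z q q' → γ-irr f e' _ q' q ; ((i , inj₂ r) , ()) })

    copair-ι₂-R : Sim.R (copair ∘S ι₂) → g.R
    copair-ι₂-R ((i , inj₂ r) , _) = r
    copair-ι₂-R ((i , inj₁ r) , ())

    copair-ι₂ : (copair ∘S ι₂) ≈S g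
    copair-ι₂ = ≈-intro (copair ∘S ι₂) g copair-ι₂-R (λ r → (g.r₁ r , inj₂ r) , refl)
      (λ { ((i , inj₂ r) , refl) → refl ; ((i , inj₁ r) , ()) })
      (λ r → refl)
      (λ { ((i , inj₂ r) , refl) → refl ; ((i , inj₁ r) , ()) })
      (λ { ((i , inj₂ r) , _) → refl ; ((i , inj₁ r) , ()) })
      (λ { ((i , inj₂ r) , _) x e e' → α-irr g e' _ ; ((i , inj₁ r) , ()) })
      (λ { ((i , inj₂ r) , _) x e e' z q q' → β-irr g e' _ q' q ; ((i , inj₁ r) , ()) })
      (λ { ((i , inj₂ r) , _) x e e' z q q' → γ-irr g e' _ q' q ; ((i , inj₁ r) , ()) })

  module CopairingUnique (X : Poly) (f : Sim P₁ X) (g : Sim P₂ X) (k' : Sim (P₁ ⊕ P₂) X)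
                         (E₁ : (k' ∘S ι₁) ≈S f) (E₂ : (k' ∘S ι₂) ≈S g) where
    open Copairing X f g
    private
      module k' = Sim k'
      module E₁ = SimEquiv E₁
      module E₂ = SimEquiv E₂
      module C₁ = Sim (k' ∘S ι₁)
      module C₂ = Sim (k' ∘S ι₂)

    -- r ∈ R_k' lies over one summand v of I₁ ⊎ I₂, hence in the span of
    -- k' ∘ ι₁ or of k' ∘ ι₂, which E₁ resp. E₂ identify with R_f resp. R_g.
    split : (r : k'.R) (v : I P₁ ⊎ I P₂) → v ≡ k'.r₁ r → kR
    split r (inj₁ i) e = inj₁ (E₁.φ ((i , r) , e))
    split r (inj₂ j) e = inj₂ (E₂.φ ((j , r) , e))

    φ : k'.R → kR
    φ r = split r (k'.r₁ r) refl

    φ-split : ∀ r v (e : v ≡ k'.r₁ r) → φ r ≡ split r v e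
    φ-split r _ refl = refl

    ψ : kR → k'.R
    ψ (inj₁ s) = proj₂ (proj₁ (E₁.ψ s))
    ψ (inj₂ s) = proj₂ (proj₁ (E₂.ψ s))

    ψ-split : ∀ r v e → ψ (split r v e) ≡ r
    ψ-split r (inj₁ i) e = cong (λ c → proj₂ (proj₁ c)) (E₁.ψφ ((i , r) , e))
    ψ-split r (inj₂ j) e = cong (λ c → proj₂ (proj₁ c)) (E₂.ψφ ((j , r) , e))

    φψ : ∀ s → φ (ψ s) ≡ s
    φψ (inj₁ s) = trans (φ-split _ _ (proj₂ (E₁.ψ s))) (cong inj₁ (E₁.φψ s))
    φψ (inj₂ s) = trans (φ-split _ _ (proj₂ (E₂.ψ s))) (cong inj₂ (E₂.φψ s))

    split-r₁ : ∀ r v e → kr₁ (split r v e) ≡ k'.r₁ r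
    split-r₁ r (inj₁ i) e = trans (cong inj₁ (E₁.φ-r₁ ((i , r) , e))) e
    split-r₁ r (inj₂ i) e = trans (cong inj₂ (E₂.φ-r₁ ((i , r) , e))) e

    split-r₂ : ∀ r v e → kr₂ (split r v e) ≡ k'.r₂ r
    split-r₂ r (inj₁ i) e = E₁.φ-r₂ ((i , r) , e)
    split-r₂ r (inj₂ i) e = E₂.φ-r₂ ((i , r) , e)

    split-α : ∀ r v ev x (e : a (P₁ ⊕ P₂) x ≡ k'.r₁ r) (e' : a (P₁ ⊕ P₂) x ≡ kr₁ (split r v ev))
            → kα (split r v ev , x , e') ≡ k'.α (r , x , e)
    split-α r (inj₁ i) ev (inj₁ x) e e' =
      trans (α-irr f _ _)
        (trans (E₁.φ-α (((i , r) , ev) , x , inj₁-injective (trans e (sym ev)))) (α-irr k' _ e))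
    split-α r (inj₁ i) ev (inj₂ x) e ()
    split-α r (inj₂ i) ev (inj₂ x) e e' =
      trans (α-irr g _ _)
        (trans (E₂.φ-α (((i , r) , ev) , x , inj₂-injective (trans e (sym ev)))) (α-irr k' _ e))
    split-α r (inj₂ i) ev (inj₁ x) e ()

    split-β : ∀ r v ev x (e : a (P₁ ⊕ P₂) x ≡ k'.r₁ r) (e' : a (P₁ ⊕ P₂) x ≡ kr₁ (split r v ev)) z
              (q : d X z ≡ k'.α (r , x , e)) (q' : d X z ≡ kα (split r v ev , x , e'))
            → kβ ((split r v ev , x , e') , z , q') ≡ k'.β ((r , x , e) , z , q)
    split-β r (inj₁ i) ev (inj₁ x) e e' z q q' =
      trans (cong inj₁ (trans (β-irr f _ _ q' _) (E₁.φ-β t)))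
        (trans (inj₁-ιβ₁ _ _ _) (β-irr k' _ e _ q))
      where t = (((i , r) , ev) , x , inj₁-injective (trans e (sym ev))) , z , trans q (α-irr k' e _)
    split-β r (inj₁ i) ev (inj₂ x) e () z q q'
    split-β r (inj₂ i) ev (inj₂ x) e e' z q q' =
      trans (cong inj₂ (trans (β-irr g _ _ q' _) (E₂.φ-β t)))
        (trans (inj₂-ιβ₂ _ _ _) (β-irr k' _ e _ q))
      where t = (((i , r) , ev) , x , inj₂-injective (trans e (sym ev))) , z , trans q (α-irr k' e _)
    split-β r (inj₂ i) ev (inj₁ x) e () z q q'

    split-γ : ∀ r v ev x (e : a (P₁ ⊕ P₂) x ≡ k'.r₁ r) (e' : a (P₁ ⊕ P₂) x ≡ kr₁ (split r v ev)) z
              (q : d X z ≡ k'.α (r , x , e)) (q' : d X z ≡ kα (split r v ev , x , e'))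
            → kγ ((split r v ev , x , e') , z , q') ≡ φ (k'.γ ((r , x , e) , z , q))
    split-γ r (inj₁ i) ev (inj₁ x) e e' z q q' =
      trans (cong inj₁ (trans (γ-irr f _ _ q' _) (E₁.φ-γ t)))
        (trans (sym (φ-split _ _ (proj₂ (C₁.γ t)))) (cong φ (γ-irr k' _ e _ q)))
      where t = (((i , r) , ev) , x , inj₁-injective (trans e (sym ev))) , z , trans q (α-irr k' e _)
    split-γ r (inj₁ i) ev (inj₂ x) e () z q q'
    split-γ r (inj₂ i) ev (inj₂ x) e e' z q q' =
      trans (cong inj₂ (trans (γ-irr g _ _ q' _) (E₂.φ-γ t)))
        (trans (sym (φ-split _ _ (proj₂ (C₂.γ t)))) (cong φ (γ-irr k' _ e _ q)))
      where t = (((i , r) , ev) , x , inj₂-injective (trans e (sym ev))) , z , trans q (α-irr k' e _)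
    split-γ r (inj₂ i) ev (inj₁ x) e () z q q'

    copair-unique : k' ≈S copair
    copair-unique = ≈-intro k' copair φ ψ (λ r → ψ-split r _ refl) φψ
      (λ r → split-r₁ r _ refl) (λ r → split-r₂ r _ refl)
      (λ r → split-α r _ refl) (λ r → split-β r _ refl) (λ r → split-γ r _ refl)

  coproduct : IsCoproduct P₁ P₂ (P₁ ⊕ P₂)
  coproduct = ι₁ , ι₂ , λ X f g → let open Copairing X f g in
    copair , copair-ι₁ , copair-ι₂ , λ k' E₁ E₂ → CopairingUnique.copair-unique X f g k' E₁ E₂

lemma3p4 : ((P₁ P₂ : Poly) → IsProduct P₁ P₂ (P₁ ⊕ P₂) × IsCoproduct P₁ P₂ (P₁ ⊕ P₂))
    × IsZeroObject Zero
lemma3p4 = (λ P₁ P₂ → Product.product P₁ P₂ , Coproduct.coproduct P₁ P₂)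
         , zero-initial , zero-terminal
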